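{- For every positive integer $h$ and every $S\in\{x,x+1\}\cup\mathcal{F}$, the polynomial $\sigma(S^{2h})=1+S+S^2+\cdots+S^{2h}$ is odd and square-free.
   Context: All polynomials are in $\mathbb{F}_2[x]$; $\sigma(A)$ is the sum of all divisors of $A$. A polynomial is odd if it has no linear factor ($x$ or $x+1$). $\overline{T}(x):=T(x+1)$; for $Q$ and positive integers $a,b,c$, $Q^{abc}:=1+x^a(x+1)^bQ^c$. $\mathcal{F}=\{M_1,\ldots,M_{13},S_1,\ldots,S_{15}\}$ where $M_1=1+x+x^2$, $M_2=1+x+x^3$, $M_3=1+x^2+x^3$, $M_4=1+x+x^2+x^3+x^4$, $M_5=1+x^3+x^4$, $M_6=1+x^3+x^5$, $M_7=1+x^3+x^7$, $M_8=1+x^6+x^7$, $M_9=\overline{M_6}$, $M_{10}=\overline{M_7}$, $M_{11}=\overline{M_8}$, $M_{12}=x^9+x+1$, $M_{13}=x^9+x^8+1$; $S_1=M_1^{111}$, $S_2=M_1^{221}$, $S_3=M_1^{134}$, $S_4=M_1^{311}$, $S_5=M_1^{131}$, $S_6=M_1^{314}$, $S_7=M_1^{113}$, $S_8=M_1^{331}$, $S_9=M_1^{115}$, $S_{10}=M_1^{411}$, $S_{11}=M_1^{121}$, $S_{12}=M_1^{212}$, $S_{13}=M_1^{141}$, $S_{14}=M_1^{211}$, $S_{15}=M_1^{122}$. -}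

module Defs where

open import Data.Bool using (Bool; true; false; _xor_; if_then_else_)
open import Data.List using (List; []; _∷_)
open import Data.Nat using (ℕ; zero; suc)
open import Data.Product using (∃; _×_)
open import Relation.Binary.PropositionalEquality using (_≡_)
open import Relation.Nullary using (¬_)

-- Polynomials in F₂[x]: coefficient lists, lowest degree first
-- (true = 1, false = 0). Trailing zeros are allowed; equality of
-- polynomials is equality of normal forms (see _≈_).
Poly : Set
Poly = List Bool

cons′ : Bool → Poly → Poly
cons′ false [] = []
cons′ b r = b ∷ r

norm : Poly → Poly
norm [] = []
norm (b ∷ p) = cons′ b (norm p)

infix 4 _≈_
_≈_ : Poly → Poly → Set
p ≈ q = norm p ≡ norm q

infixl 6 _+ₚ_
_+ₚ_ : Poly → Poly → Poly
[] +ₚ q = q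
(a ∷ p) +ₚ [] = a ∷ p
(a ∷ p) +ₚ (b ∷ q) = (a xor b) ∷ (p +ₚ q)

infixl 7 _*ₚ_
_*ₚ_ : Poly → Poly → Poly
[] *ₚ q = []
(a ∷ p) *ₚ q = (if a then q else []) +ₚ (false ∷ (p *ₚ q))

one : Poly
one = true ∷ []

X : Poly
X = false ∷ true ∷ []

X+1 : Poly
X+1 = true ∷ true ∷ []

infixr 8 _^ₚ_
_^ₚ_ : Poly → ℕ → Poly
p ^ₚ zero = one
p ^ₚ suc n = p *ₚ (p ^ₚ n)

infix 4 _∣ₚ_
_∣ₚ_ : Poly → Poly → Set
d ∣ₚ p = ∃ λ c → d *ₚ c ≈ p

Odd : Poly → Set
Odd p = ¬ (X ∣ₚ p) × ¬ (X+1 ∣ₚ p)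

-- square-free: every D with D² ∣ P is a unit (the only unit of F₂[x] is 1)
SquareFree : Poly → Set
SquareFree p = ∀ d → d *ₚ d ∣ₚ p → d ≈ one

-- T̄(x) := T(x+1)  (Horner evaluation at x+1)
bar : Poly → Poly
bar [] = []
bar (c ∷ t) = (c ∷ []) +ₚ X+1 *ₚ bar t

sup : Poly → ℕ → ℕ → ℕ → Poly
sup Q a b c = one +ₚ (X ^ₚ a) *ₚ (X+1 ^ₚ b) *ₚ (Q ^ₚ c)

geomSum : Poly → ℕ → Poly
geomSum S zero = one
geomSum S (suc n) = geomSum S n +ₚ S ^ₚ suc n

M1 M2 M3 M4 M5 M6 M7 M8 M9 M10 M11 M12 M13 : Poly
M1 = true ∷ true ∷ true ∷ []                                   -- 1+x+x²
M2 = true ∷ true ∷ false ∷ true ∷ []                           -- 1+x+x³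
M3 = true ∷ false ∷ true ∷ true ∷ []                           -- 1+x²+x³
M4 = true ∷ true ∷ true ∷ true ∷ true ∷ []                     -- 1+x+x²+x³+x⁴
M5 = true ∷ false ∷ false ∷ true ∷ true ∷ []                   -- 1+x³+x⁴
M6 = true ∷ false ∷ false ∷ true ∷ false ∷ true ∷ []           -- 1+x³+x⁵
M7 = true ∷ false ∷ false ∷ true ∷ false ∷ false ∷ false ∷ true ∷ []   -- 1+x³+x⁷
M8 = true ∷ false ∷ false ∷ false ∷ false ∷ false ∷ true ∷ true ∷ []   -- 1+x⁶+x⁷
M9 = bar M6
M10 = bar M7
M11 = bar M8
M12 = true ∷ true ∷ false ∷ false ∷ false ∷ false ∷ false ∷ false ∷ false ∷ true ∷ []  -- x⁹+x+1
M13 = true ∷ false ∷ false ∷ false ∷ false ∷ false ∷ false ∷ false ∷ true ∷ true ∷ []  -- x⁹+x⁸+1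

S1 S2 S3 S4 S5 S6 S7 S8 S9 S10 S11 S12 S13 S14 S15 : Poly
S1 = sup M1 1 1 1
S2 = sup M1 2 2 1
S3 = sup M1 1 3 4
S4 = sup M1 3 1 1
S5 = sup M1 1 3 1
S6 = sup M1 3 1 4
S7 = sup M1 1 1 3
S8 = sup M1 3 3 1
S9 = sup M1 1 1 5
S10 = sup M1 4 1 1
S11 = sup M1 1 2 1
S12 = sup M1 2 1 2
S13 = sup M1 1 4 1
S14 = sup M1 2 1 1
S15 = sup M1 1 2 2

-- {x, x+1} ∪ 𝓕
candidates : List Poly
candidates = X ∷ X+1 ∷ M1 ∷ M2 ∷ M3 ∷ M4 ∷ M5 ∷ M6 ∷ M7 ∷ M8 ∷ M9 ∷ M10 ∷ M11 ∷ M12 ∷ M13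
  ∷ S1 ∷ S2 ∷ S3 ∷ S4 ∷ S5 ∷ S6 ∷ S7 ∷ S8 ∷ S9 ∷ S10 ∷ S11 ∷ S12 ∷ S13 ∷ S14 ∷ S15 ∷ []

module Submission where

-- Pairing terms gives
--   P = 1 + Q·G   with Q = S(S + 1) and G = Σ_{i<h} S^{2i},
-- so every divisor of P is coprime to Q.
-- * Odd: x and x + 1 divide Q (one of S, S + 1 has a root at 0, resp. 1),
--   hence neither divides P.
-- * Square-free: G is a sum of squares, so P′ = Q′·G = S′·G (characteristic 2).
--   If d² ∣ P then d ∣ P′, and from P = G·(1 + S) + S^{2h} we get
--   d ∣ S^{2h}·S′, hence d ∣ S′ since d is coprime to S.  Whenever S′ ∣ Q²
--   this forces d ∣ Q², so d ∣ Q and d is a unit.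

open import Defs
open import Data.Nat using (ℕ; zero; suc; _*_; _≥_; _+_; _≤_; _<_; _≟_; z≤n; s≤s; s≤s⁻¹)
open import Data.Nat.Properties using (*-suc; ≤-refl; ≤-trans; ≤-reflexive; n≢0⇒n>0; n≤0⇒n≡0; +-comm; +-monoˡ-≤; +-monoʳ-≤; module ≤-Reasoning)
open import Data.Bool using (Bool; true; false; _xor_; if_then_else_; not)
open import Data.Bool.Properties using (xor-comm; xor-assoc)
open import Data.List using (List; []; _∷_; length; foldr)
open import Data.List.Membership.Propositional using (_∈_)
open import Data.List.Relation.Unary.All using (All; []; _∷_; lookup)
open import Data.Maybe using (Maybe; just; nothing)
open import Data.Product using (_×_; _,_)
open import Relation.Nullary using (yes; no; ¬_)
open import Relation.Binary.PropositionalEquality using (_≡_; refl; sym; trans; cong; cong₂; module ≡-Reasoning)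
open import Relation.Binary.Structures using (IsEquivalence)
open import Relation.Binary.Bundles using (Setoid)
open import Algebra.Bundles using (CommutativeSemiring)
import Algebra.Properties.Semiring.Mult as SemiringMult
import Algebra.Solver.Ring.NaturalCoefficients as NaturalCoefficients
import Relation.Binary.Reasoning.Setoid as SetoidReasoning

-- Equality of polynomials: equal normal forms.  Wrapping Defs._≈_ in a
-- record keeps Agda from unfolding it, so both sides stay inferable.
infix 4 _≃_
record _≃_ (p q : Poly) : Set where
  constructor eqv
  field prf : norm p ≡ norm q
open _≃_ public

≃-refl : ∀ {p} → p ≃ p
≃-refl = eqv refl

≃-sym : ∀ {p q} → p ≃ q → q ≃ p
≃-sym (eqv e) = eqv (sym e)

≃-trans : ∀ {p q r} → p ≃ q → q ≃ r → p ≃ r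
≃-trans (eqv e) (eqv f) = eqv (trans e f)

≡⇒≃ : ∀ {p q} → p ≡ q → p ≃ q
≡⇒≃ refl = ≃-refl

≃-isEquivalence : IsEquivalence _≃_
≃-isEquivalence = record { refl = ≃-refl ; sym = ≃-sym ; trans = ≃-trans }

≃-setoid : Setoid _ _
≃-setoid = record { isEquivalence = ≃-isEquivalence }

module ≃-Reasoning = SetoidReasoning ≃-setoid

norm-idem : ∀ p → norm (norm p) ≡ norm p
norm-idem [] = refl
norm-idem (b ∷ p) = norm-cons′ b (norm-idem p)
  where
  norm-cons′ : ∀ b {r} → norm r ≡ r → norm (cons′ b r) ≡ cons′ b r
  norm-cons′ false {[]} e = refl
  norm-cons′ false {_ ∷ _} e = cong (cons′ false) e
  norm-cons′ true e = cong (cons′ true) e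

norm-≃ : ∀ p → norm p ≃ p
norm-≃ p = eqv (norm-idem p)

∷-cong : ∀ b {p q} → p ≃ q → b ∷ p ≃ b ∷ q
∷-cong b (eqv e) = eqv (cong (cons′ b) e)

-- Addition is coefficientwise xor, so its laws hold on the nose.

+-comm-≡ : ∀ p q → p +ₚ q ≡ q +ₚ p
+-comm-≡ [] [] = refl
+-comm-≡ [] (_ ∷ _) = refl
+-comm-≡ (_ ∷ _) [] = refl
+-comm-≡ (a ∷ p) (b ∷ q) = cong₂ _∷_ (xor-comm a b) (+-comm-≡ p q)

+-assoc-≡ : ∀ p q r → (p +ₚ q) +ₚ r ≡ p +ₚ (q +ₚ r)
+-assoc-≡ [] q r = refl
+-assoc-≡ (a ∷ p) [] r = refl
+-assoc-≡ (a ∷ p) (b ∷ q) [] = refl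
+-assoc-≡ (a ∷ p) (b ∷ q) (c ∷ r) = cong₂ _∷_ (xor-assoc a b c) (+-assoc-≡ p q r)

+-identityʳ-≡ : ∀ p → p +ₚ [] ≡ p
+-identityʳ-≡ [] = refl
+-identityʳ-≡ (_ ∷ _) = refl

+-normˡ : ∀ p q → norm (p +ₚ q) ≡ norm (norm p +ₚ q)
+-normˡ [] q = refl
+-normˡ (a ∷ p) [] = sym (trans (cong norm (+-identityʳ-≡ (norm (a ∷ p)))) (norm-idem (a ∷ p)))
+-normˡ (a ∷ p) (b ∷ q) with norm p | +-normˡ p q
+-normˡ (false ∷ p) (b ∷ q) | [] | ih = cong (cons′ b) ih
+-normˡ (true ∷ p) (b ∷ q) | [] | ih = cong (cons′ (not b)) ih
+-normˡ (false ∷ p) (b ∷ q) | _ ∷ _ | ih = cong (cons′ b) ih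
+-normˡ (true ∷ p) (b ∷ q) | _ ∷ _ | ih = cong (cons′ (not b)) ih

+-cong : ∀ {p p′ q q′} → p ≃ p′ → q ≃ q′ → p +ₚ q ≃ p′ +ₚ q′
+-cong {p} {p′} {q} {q′} (eqv e) (eqv f) = eqv (begin
  norm (p +ₚ q)         ≡⟨ +-normˡ p q ⟩
  norm (norm p +ₚ q)    ≡⟨ cong (λ z → norm (z +ₚ q)) e ⟩
  norm (norm p′ +ₚ q)   ≡⟨ sym (+-normˡ p′ q) ⟩
  norm (p′ +ₚ q)        ≡⟨ cong norm (+-comm-≡ p′ q) ⟩
  norm (q +ₚ p′)        ≡⟨ +-normˡ q p′ ⟩
  norm (norm q +ₚ p′)   ≡⟨ cong (λ z → norm (z +ₚ p′)) f ⟩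
  norm (norm q′ +ₚ p′)  ≡⟨ sym (+-normˡ q′ p′) ⟩
  norm (q′ +ₚ p′)       ≡⟨ cong norm (+-comm-≡ q′ p′) ⟩
  norm (p′ +ₚ q′)       ∎)
  where open ≡-Reasoning

sc : Bool → Poly → Poly
sc a q = if a then q else []

sc-cong : ∀ a {p q} → p ≃ q → sc a p ≃ sc a q
sc-cong true e = e
sc-cong false e = ≃-refl

+-self : ∀ p → p +ₚ p ≃ []
+-self [] = ≃-refl
+-self (false ∷ p) = eqv (prf (∷-cong false (+-self p)))
+-self (true ∷ p) = eqv (prf (∷-cong false (+-self p)))

add-zero-as-double : ∀ p u → p +ₚ (u +ₚ u) ≃ p
add-zero-as-double p u = ≃-trans (+-cong (≃-refl {p}) (+-self u)) (≡⇒≃ (+-identityʳ-≡ p))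

sc-xor : ∀ a b r → sc (a xor b) r ≃ sc a r +ₚ sc b r
sc-xor false b r = ≃-refl
sc-xor true false r = ≡⇒≃ (sym (+-identityʳ-≡ r))
sc-xor true true r = ≃-sym (+-self r)

*-normˡ : ∀ p q → p *ₚ q ≃ norm p *ₚ q
*-normˡ [] q = ≃-refl
*-normˡ (a ∷ p) q with norm p | *-normˡ p q
*-normˡ (true ∷ p) q | _ ∷ _ | ih = +-cong ≃-refl (∷-cong false ih)
*-normˡ (false ∷ p) q | _ ∷ _ | ih = ∷-cong false ih
*-normˡ (true ∷ p) q | [] | ih = +-cong ≃-refl (∷-cong false ih)
*-normˡ (false ∷ p) q | [] | ih = eqv (prf (∷-cong false ih))

*-normʳ : ∀ p q → p *ₚ q ≃ p *ₚ norm q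
*-normʳ [] q = ≃-refl
*-normʳ (a ∷ p) q = +-cong (sc-cong a (≃-sym (norm-≃ q))) (∷-cong false (*-normʳ p q))

*-cong : ∀ {p p′ q q′} → p ≃ p′ → q ≃ q′ → p *ₚ q ≃ p′ *ₚ q′
*-cong {p} {p′} {q} {q′} (eqv e) (eqv f) = begin
  p *ₚ q              ≈⟨ *-normˡ p q ⟩
  norm p *ₚ q         ≡⟨ cong (_*ₚ q) e ⟩
  norm p′ *ₚ q        ≈⟨ ≃-sym (*-normˡ p′ q) ⟩
  p′ *ₚ q             ≈⟨ *-normʳ p′ q ⟩
  p′ *ₚ norm q        ≡⟨ cong (p′ *ₚ_) f ⟩
  p′ *ₚ norm q′       ≈⟨ ≃-sym (*-normʳ p′ q′) ⟩
  p′ *ₚ q′            ∎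
  where open ≃-Reasoning

*-zeroʳ : ∀ p → p *ₚ [] ≃ []
*-zeroʳ [] = ≃-refl
*-zeroʳ (false ∷ p) = eqv (prf (∷-cong false (*-zeroʳ p)))
*-zeroʳ (true ∷ p) = eqv (prf (∷-cong false (*-zeroʳ p)))

*-identityˡ : ∀ p → one *ₚ p ≃ p
*-identityˡ [] = eqv refl
*-identityˡ (false ∷ p) = ≡⇒≃ (cong (false ∷_) (+-identityʳ-≡ p))
*-identityˡ (true ∷ p) = ≡⇒≃ (cong (true ∷_) (+-identityʳ-≡ p))

+-interchange : ∀ a b c d → (a +ₚ b) +ₚ (c +ₚ d) ≡ (a +ₚ c) +ₚ (b +ₚ d)
+-interchange a b c d = begin
  (a +ₚ b) +ₚ (c +ₚ d)   ≡⟨ +-assoc-≡ a b (c +ₚ d) ⟩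
  a +ₚ (b +ₚ (c +ₚ d))   ≡⟨ cong (a +ₚ_) (sym (+-assoc-≡ b c d)) ⟩
  a +ₚ ((b +ₚ c) +ₚ d)   ≡⟨ cong (λ z → a +ₚ (z +ₚ d)) (+-comm-≡ b c) ⟩
  a +ₚ ((c +ₚ b) +ₚ d)   ≡⟨ cong (a +ₚ_) (+-assoc-≡ c b d) ⟩
  a +ₚ (c +ₚ (b +ₚ d))   ≡⟨ sym (+-assoc-≡ a c (b +ₚ d)) ⟩
  (a +ₚ c) +ₚ (b +ₚ d)   ∎
  where open ≡-Reasoning

*-distribʳ : ∀ p q r → (p +ₚ q) *ₚ r ≃ p *ₚ r +ₚ q *ₚ r
*-distribʳ [] q r = ≃-refl
*-distribʳ (a ∷ p) [] r = ≡⇒≃ (sym (+-identityʳ-≡ _))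
*-distribʳ (a ∷ p) (b ∷ q) r =
  ≃-trans (+-cong (sc-xor a b r) (∷-cong false (*-distribʳ p q r)))
          (≡⇒≃ (+-interchange (sc a r) (sc b r) (false ∷ (p *ₚ r)) (false ∷ (q *ₚ r))))

*-∷ʳ : ∀ p b q → p *ₚ (b ∷ q) ≃ sc b p +ₚ (false ∷ (p *ₚ q))
*-∷ʳ [] false q = eqv refl
*-∷ʳ [] true q = eqv refl
*-∷ʳ (a ∷ p) b q =
  ≃-trans (+-cong (≃-refl {sc a (b ∷ q)}) (∷-cong false (*-∷ʳ p b q))) (≡⇒≃ (swap a b))
  where
  F = false ∷ (p *ₚ q)
  swap : ∀ a b → sc a (b ∷ q) +ₚ (false ∷ (sc b p +ₚ F)) ≡ sc b (a ∷ p) +ₚ (false ∷ (sc a q +ₚ F))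
  swap true true = cong (true ∷_) (begin
    q +ₚ (p +ₚ F)   ≡⟨ sym (+-assoc-≡ q p F) ⟩
    (q +ₚ p) +ₚ F   ≡⟨ cong (_+ₚ F) (+-comm-≡ q p) ⟩
    (p +ₚ q) +ₚ F   ≡⟨ +-assoc-≡ p q F ⟩
    p +ₚ (q +ₚ F)   ∎)
    where open ≡-Reasoning
  swap true false = refl
  swap false true = refl
  swap false false = refl

*-comm : ∀ p q → p *ₚ q ≃ q *ₚ p
*-comm [] q = ≃-sym (*-zeroʳ q)
*-comm (a ∷ p) q = ≃-sym (≃-trans (*-∷ʳ q a p) (+-cong (≃-refl {sc a q}) (∷-cong false (*-comm q p))))

*-assoc : ∀ p q r → (p *ₚ q) *ₚ r ≃ p *ₚ (q *ₚ r)
*-assoc [] q r = ≃-refl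
*-assoc (a ∷ p) q r =
  ≃-trans (*-distribʳ (sc a q) (false ∷ (p *ₚ q)) r)
          (+-cong (≡⇒≃ (sc-* a)) (∷-cong false (*-assoc p q r)))
  where
  sc-* : ∀ a → sc a q *ₚ r ≡ sc a (q *ₚ r)
  sc-* true = refl
  sc-* false = refl

*-identityʳ : ∀ p → p *ₚ one ≃ p
*-identityʳ p = ≃-trans (*-comm p one) (*-identityˡ p)

*-distribˡ : ∀ p q r → p *ₚ (q +ₚ r) ≃ p *ₚ q +ₚ p *ₚ r
*-distribˡ p q r =
  ≃-trans (*-comm p (q +ₚ r)) (≃-trans (*-distribʳ q r p) (+-cong (*-comm q p) (*-comm r p)))

-- 𝔽₂[x] as a commutative semiring (it is a ring whose negation is the identity).
polySemiring : CommutativeSemiring _ _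
polySemiring = record
  { Carrier = Poly ; _≈_ = _≃_ ; _+_ = _+ₚ_ ; _*_ = _*ₚ_ ; 0# = [] ; 1# = one
  ; isCommutativeSemiring = record
    { isSemiring = record
      { isSemiringWithoutAnnihilatingZero = record
        { +-isCommutativeMonoid = record
          { isMonoid = record
            { isSemigroup = record
              { isMagma = record { isEquivalence = ≃-isEquivalence ; ∙-cong = +-cong }
              ; assoc = λ p q r → ≡⇒≃ (+-assoc-≡ p q r) }
            ; identity = (λ p → ≃-refl) , (λ p → ≡⇒≃ (+-identityʳ-≡ p)) }
          ; comm = λ p q → ≡⇒≃ (+-comm-≡ p q) }
        ; *-cong = *-cong
        ; *-assoc = *-assoc
        ; *-identity = *-identityˡ , *-identityʳ
        ; distrib = *-distribˡ , (λ r p q → *-distribʳ p q r) }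
      ; zero = (λ p → ≃-refl) , *-zeroʳ }
    ; *-comm = *-comm } }

open SemiringMult (CommutativeSemiring.semiring polySemiring) using () renaming (_×_ to _×ₚ_)

-- The solver only needs to recognise syntactically equal numerals; the
-- characteristic-2 law p + p = 0 is always applied explicitly (+-self).
numeral-≟ : ∀ m n → Maybe (m ×ₚ one ≃ n ×ₚ one)
numeral-≟ m n with m ≟ n
... | yes refl = just ≃-refl
... | no _ = nothing

open NaturalCoefficients polySemiring numeral-≟ public using (solve; _:=_; _:+_; _:*_; con)

X-* : ∀ u → false ∷ u ≃ X *ₚ u
X-* u = ∷-cong false (≃-sym (*-identityˡ u))

D : Poly → Poly
D [] = []
D (a ∷ q) = q +ₚ (false ∷ D q)

D-norm : ∀ p → D p ≃ D (norm p)
D-norm [] = ≃-refl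
D-norm (a ∷ p) with norm p | norm-≃ p | D-norm p
D-norm (true ∷ p) | _ ∷ _ | e | ih = +-cong (≃-sym e) (∷-cong false ih)
D-norm (false ∷ p) | _ ∷ _ | e | ih = +-cong (≃-sym e) (∷-cong false ih)
D-norm (true ∷ p) | [] | e | ih = +-cong (≃-sym e) (∷-cong false ih)
D-norm (false ∷ p) | [] | e | ih = ≃-trans (+-cong (≃-sym e) (∷-cong false ih)) (eqv refl)

D-cong : ∀ {p q} → p ≃ q → D p ≃ D q
D-cong {p} {q} (eqv e) = ≃-trans (D-norm p) (≃-trans (≡⇒≃ (cong D e)) (≃-sym (D-norm q)))

D-+ : ∀ p q → D (p +ₚ q) ≃ D p +ₚ D q
D-+ [] q = ≃-refl
D-+ (a ∷ p) [] = ≡⇒≃ (sym (+-identityʳ-≡ _))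
D-+ (a ∷ p) (b ∷ q) = ≃-trans (+-cong (≃-refl {p +ₚ q}) (∷-cong false (D-+ p q)))
  (≡⇒≃ (+-interchange p q (false ∷ D p) (false ∷ D q)))

D-one : D one ≃ []
D-one = eqv refl

D-* : ∀ p q → D (p *ₚ q) ≃ D p *ₚ q +ₚ p *ₚ D q
D-* [] q = ≃-refl
D-* (a ∷ p) q = begin
  D (sc a q +ₚ (false ∷ (p *ₚ q)))                  ≈⟨ D-+ (sc a q) (false ∷ (p *ₚ q)) ⟩
  D (sc a q) +ₚ (p *ₚ q +ₚ (false ∷ D (p *ₚ q)))    ≈⟨ +-cong (≡⇒≃ (D-sc a)) (+-cong (≃-refl {p *ₚ q})
                                                          (≃-trans (X-* _) (*-cong (≃-refl {X}) (D-* p q)))) ⟩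
  sc a (D q) +ₚ (p *ₚ q +ₚ X *ₚ (D p *ₚ q +ₚ p *ₚ D q))
                        ≈⟨ rearrange (sc a (D q)) p q (D p) (D q) X ⟩
  (p +ₚ X *ₚ D p) *ₚ q +ₚ (sc a (D q) +ₚ X *ₚ (p *ₚ D q))
                        ≈⟨ ≃-sym (+-cong (*-cong (+-cong (≃-refl {p}) (X-* (D p))) (≃-refl {q}))
                                          (+-cong (≃-refl {sc a (D q)}) (X-* (p *ₚ D q)))) ⟩
  D (a ∷ p) *ₚ q +ₚ (a ∷ p) *ₚ D q                  ∎
  where
  open ≃-Reasoning
  D-sc : ∀ a → D (sc a q) ≡ sc a (D q)
  D-sc true = refl
  D-sc false = refl
  rearrange : ∀ A p q dp dq x → A +ₚ (p *ₚ q +ₚ x *ₚ (dp *ₚ q +ₚ p *ₚ dq))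
                                ≃ (p +ₚ x *ₚ dp) *ₚ q +ₚ (A +ₚ x *ₚ (p *ₚ dq))
  rearrange = solve 6 (λ A p q dp dq x → A :+ (p :* q :+ x :* (dp :* q :+ p :* dq))
                                         := (p :+ x :* dp) :* q :+ (A :+ x :* (p :* dq))) ≃-refl

D-square : ∀ d → D (d *ₚ d) ≃ []
D-square d = ≃-trans (D-* d d) (≃-trans (+-cong (*-comm (D d) d) ≃-refl) (+-self (d *ₚ D d)))

-- Divisibility up to ≃, as a record so that the quotient is explicit.
infix 4 _∣_
record _∣_ (d p : Poly) : Set where
  constructor divides
  field
    quotient : Poly
    equation : d *ₚ quotient ≃ p

∣-respʳ : ∀ {d p q} → d ∣ p → p ≃ q → d ∣ q
∣-respʳ (divides c e) f = divides c (≃-trans e f)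

∣-+ : ∀ {d p q} → d ∣ p → d ∣ q → d ∣ p +ₚ q
∣-+ {d} (divides c e) (divides c′ e′) = divides (c +ₚ c′) (≃-trans (*-distribˡ d c c′) (+-cong e e′))

∣-*ʳ : ∀ {d p} r → d ∣ p → d ∣ p *ₚ r
∣-*ʳ {d} r (divides c e) = divides (c *ₚ r) (≃-trans (≃-sym (*-assoc d c r)) (*-cong e ≃-refl))

∣-*ˡ : ∀ {d p} r → d ∣ p → d ∣ r *ₚ p
∣-*ˡ {d} {p} r d∣p = ∣-respʳ (∣-*ʳ r d∣p) (*-comm p r)

∣-trans : ∀ {d p q} → d ∣ p → p ∣ q → d ∣ q
∣-trans {d} (divides c e) (divides c′ e′) =
  divides (c *ₚ c′) (≃-trans (≃-sym (*-assoc d c c′)) (≃-trans (*-cong e ≃-refl) e′))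

-- If P ≡ 1 (mod Q) then every divisor of P is coprime to Q, so it can be
-- cancelled from Q·R.
cancel-coprime : ∀ {d P Q C} R → d ∣ P → P ≃ one +ₚ Q *ₚ C → d ∣ Q *ₚ R → d ∣ R
cancel-coprime {d} {P} {Q} {C} R d∣P e d∣QR =
  ∣-respʳ (∣-+ (∣-*ˡ R d∣P) (∣-*ʳ C d∣QR))
    (≃-trans (+-cong (*-cong (≃-refl {R}) e) (≃-refl {(Q *ₚ R) *ₚ C})) (bezout R Q C))
  where
  bezout : ∀ R Q C → R *ₚ (one +ₚ Q *ₚ C) +ₚ (Q *ₚ R) *ₚ C ≃ R
  bezout = solve 3 (λ R Q C → R :* (con 1 :+ Q :* C) :+ (Q :* R) :* C := R) ≃-refl

cancel-coprime-power : ∀ {d P Q C} k R → d ∣ P → P ≃ one +ₚ Q *ₚ C → d ∣ (Q ^ₚ k) *ₚ R → d ∣ R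
cancel-coprime-power zero R d∣P e d∣R = ∣-respʳ d∣R (*-identityˡ R)
cancel-coprime-power {Q = Q} (suc k) R d∣P e d∣QQᵏR =
  cancel-coprime-power k R d∣P e
    (cancel-coprime {Q = Q} ((Q ^ₚ k) *ₚ R) d∣P e (∣-respʳ d∣QQᵏR (*-assoc Q (Q ^ₚ k) R)))

square-∣ : ∀ {d p} → d *ₚ d ∣ p → d ∣ p
square-∣ {d} (divides c e) = divides (d *ₚ c) (≃-trans (≃-sym (*-assoc d d c)) e)

-- (d²c)′ = d²c′ because (d²)′ = 0.
square-∣-derivative : ∀ {d p} → d *ₚ d ∣ p → d ∣ D p
square-∣-derivative {d} {p} (divides c e) = divides (d *ₚ D c) (begin
  d *ₚ (d *ₚ D c)                   ≈⟨ ≃-sym (*-assoc d d (D c)) ⟩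
  (d *ₚ d) *ₚ D c                   ≈⟨ ≃-sym (+-cong (*-cong (D-square d) (≃-refl {c})) ≃-refl) ⟩
  D (d *ₚ d) *ₚ c +ₚ (d *ₚ d) *ₚ D c ≈⟨ ≃-sym (D-* (d *ₚ d) c) ⟩
  D ((d *ₚ d) *ₚ c)                 ≈⟨ D-cong e ⟩
  D p                               ∎)
  where open ≃-Reasoning

-- len p = deg p + 1 for p ≠ 0, and len 0 = 0.
len : Poly → ℕ
len p = length (norm p)

len-cong : ∀ {p q} → p ≃ q → len p ≡ len q
len-cong (eqv e) = cong length e

len-zero : ∀ p → len p ≡ 0 → p ≃ []
len-zero p e with norm p in eq
... | [] = eqv eq
len-zero p () | _ ∷ _

len-∷ : ∀ b p → 1 ≤ len p → len (b ∷ p) ≡ suc (len p)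
len-∷ b p h with norm p
len-∷ b p () | []
len-∷ false p h | _ ∷ _ = refl
len-∷ true p h | _ ∷ _ = refl

len-∷-constant : ∀ b p → len p ≡ 0 → len (b ∷ p) ≤ 1
len-∷-constant b p e with norm p
len-∷-constant false p e | [] = z≤n
len-∷-constant true p e | [] = s≤s z≤n
len-∷-constant b p () | _ ∷ _

len-sc : ∀ a q → len (sc a q) ≤ len q
len-sc true q = ≤-refl
len-sc false q = z≤n

len-∷-< : ∀ a u {n} → 1 ≤ n → len (a ∷ u) < suc n → len u < n
len-∷-< a u {n} n≥1 h with len u ≟ 0
... | yes u0 = ≤-trans (≤-reflexive (cong suc u0)) n≥1
... | no u≢0 = s≤s⁻¹ (≤-trans (≤-reflexive (cong suc (sym (len-∷ a u (n≢0⇒n>0 u≢0))))) h)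

len-+ : ∀ u v → len u < len v → len (u +ₚ v) ≡ len v
len-+ [] v h = refl
len-+ (a ∷ u) [] ()
len-+ (a ∷ u) (b ∷ v) h with len v ≟ 0
... | yes v0 = len-cong (+-cong (len-zero (a ∷ u) (n≤0⇒n≡0 (s≤s⁻¹ (≤-trans h (len-∷-constant b v v0)))))
                               (≃-refl {b ∷ v}))
... | no v≢0 = begin-equality
  len ((a xor b) ∷ (u +ₚ v))  ≡⟨ len-∷ (a xor b) (u +ₚ v) (≤-trans v≥1 (≤-reflexive (sym ih))) ⟩
  suc (len (u +ₚ v))          ≡⟨ cong suc ih ⟩
  suc (len v)                 ≡⟨ sym (len-∷ b v v≥1) ⟩
  len (b ∷ v)                 ∎
  where
  open ≤-Reasoning
  v≥1 : 1 ≤ len v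
  v≥1 = n≢0⇒n>0 v≢0
  ih : len (u +ₚ v) ≡ len v
  ih = len-+ u v (len-∷-< a u v≥1 (≤-trans h (≤-reflexive (len-∷ b v v≥1))))

-- Degrees add under multiplication of nonzero polynomials (one inequality suffices).
len-* : ∀ p q → 1 ≤ len p → 1 ≤ len q → len p + len q ≤ suc (len (p *ₚ q))
len-* [] q () q≥1
len-* (a ∷ p) q p≥1 q≥1 with len p ≟ 0
len-* (false ∷ p) q p≥1 q≥1 | yes p0 with () ← ≤-trans p≥1 (≤-reflexive (len-cong (∷-cong false (len-zero p p0))))
len-* (true ∷ p) q p≥1 q≥1 | yes p0 = ≤-reflexive (cong₂ _+_ (len-cong p≃1) (len-cong (≃-sym pq≃q)))
  where
  p≃1 : true ∷ p ≃ one
  p≃1 = ∷-cong true (len-zero p p0)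
  pq≃q : (true ∷ p) *ₚ q ≃ q
  pq≃q = ≃-trans (*-cong p≃1 (≃-refl {q})) (*-identityˡ q)
len-* (a ∷ p) q p≥1 q≥1 | no p≢0 = begin
  len (a ∷ p) + len q             ≡⟨ cong (_+ len q) (len-∷ a p (n≢0⇒n>0 p≢0)) ⟩
  suc (len p + len q)             ≤⟨ s≤s ih ⟩
  suc (suc (len (p *ₚ q)))        ≡⟨ cong suc (sym shifted) ⟩
  suc (len ((a ∷ p) *ₚ q))        ∎
  where
  open ≤-Reasoning
  ih : len p + len q ≤ suc (len (p *ₚ q))
  ih = len-* p q (n≢0⇒n>0 p≢0) q≥1
  q≤pq : len q ≤ len (p *ₚ q)
  q≤pq = s≤s⁻¹ (≤-trans (+-monoˡ-≤ (len q) (n≢0⇒n>0 p≢0)) ih)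
  shifted : len (sc a q +ₚ (false ∷ (p *ₚ q))) ≡ suc (len (p *ₚ q))
  shifted = trans (len-+ (sc a q) (false ∷ (p *ₚ q))
                     (≤-trans (s≤s (≤-trans (len-sc a q) q≤pq)) (≤-reflexive (sym (len-∷ false (p *ₚ q) (≤-trans q≥1 q≤pq))))))
                  (len-∷ false (p *ₚ q) (≤-trans q≥1 q≤pq))

len-one : ∀ d → 1 ≤ len d → len d ≤ 1 → d ≃ one
len-one d d≥1 d≤1 with norm d in eq | norm-idem d
... | [] | _ with () ← d≥1
... | true ∷ [] | _ = eqv eq
... | false ∷ [] | ()
... | _ ∷ _ ∷ _ | _ with s≤s () ← d≤1

unit : ∀ d c → d *ₚ c ≃ one → d ≃ one
unit d c e with len d ≟ 0 | len c ≟ 0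
... | yes d0 | _ with () ← len-cong (≃-trans (≃-sym e) (*-cong (len-zero d d0) (≃-refl {c})))
... | no _ | yes c0 with () ← len-cong (≃-trans (≃-sym e) (≃-trans (*-cong (≃-refl {d}) (len-zero c c0)) (*-zeroʳ d)))
... | no d≢0 | no c≢0 = len-one d (n≢0⇒n>0 d≢0) (s≤s⁻¹ (begin
  suc (len d)        ≡⟨ +-comm 1 (len d) ⟩
  len d + 1          ≤⟨ +-monoʳ-≤ (len d) (n≢0⇒n>0 c≢0) ⟩
  len d + len c      ≤⟨ len-* d c (n≢0⇒n>0 d≢0) (n≢0⇒n>0 c≢0) ⟩
  suc (len (d *ₚ c)) ≡⟨ cong suc (len-cong e) ⟩
  2                  ∎))
  where open ≤-Reasoning

coprime-divisor-unit : ∀ {d P Q C} → d ∣ P → P ≃ one +ₚ Q *ₚ C → d ∣ Q → d ≃ one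
coprime-divisor-unit {d} {Q = Q} d∣P e d∣Q
  with cancel-coprime {Q = Q} one d∣P e (∣-respʳ d∣Q (≃-sym (*-identityʳ Q)))
... | divides c dc≃1 = unit d c dc≃1

record LinearDivision (L p : Poly) : Set where
  constructor linearDivision
  field
    quot : Poly
    rem : Bool
    equation : p ≃ L *ₚ quot +ₚ sc rem one

∷-as-sum : ∀ a p → a ∷ p ≃ sc a one +ₚ X *ₚ p
∷-as-sum a p = ≃-trans (constant-plus a) (+-cong (≃-refl {sc a one}) (X-* p))
  where
  constant-plus : ∀ a → a ∷ p ≃ sc a one +ₚ (false ∷ p)
  constant-plus true = ≃-refl
  constant-plus false = ≃-refl

divide-by-X : ∀ p → LinearDivision X p
divide-by-X [] = linearDivision [] false (eqv refl)
divide-by-X (a ∷ p) = linearDivision p a (≃-trans (∷-as-sum a p) (≡⇒≃ (+-comm-≡ (sc a one) (X *ₚ p))))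

-- Synthetic division by x + 1, by Horner's scheme.
divide-by-X+1 : ∀ p → LinearDivision X+1 p
divide-by-X+1 [] = linearDivision [] false (eqv refl)
divide-by-X+1 (a ∷ p) with divide-by-X+1 p
... | linearDivision q b e = linearDivision (X *ₚ q +ₚ sc b one) (a xor b) (begin
  a ∷ p                                                 ≈⟨ ∷-as-sum a p ⟩
  sc a one +ₚ X *ₚ p                                    ≈⟨ +-cong (≃-refl {sc a one}) (*-cong (≃-refl {X}) e) ⟩
  sc a one +ₚ X *ₚ (X+1 *ₚ q +ₚ B)                      ≈⟨ ≃-sym (add-zero-as-double (sc a one +ₚ X *ₚ (X+1 *ₚ q +ₚ B)) B) ⟩
  (sc a one +ₚ X *ₚ (X+1 *ₚ q +ₚ B)) +ₚ (B +ₚ B)        ≈⟨ shift (sc a one) B q X ⟩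
  X+1 *ₚ (X *ₚ q +ₚ B) +ₚ (sc a one +ₚ B)               ≈⟨ +-cong (≃-refl {X+1 *ₚ (X *ₚ q +ₚ B)}) (≃-sym (sc-xor a b one)) ⟩
  X+1 *ₚ (X *ₚ q +ₚ B) +ₚ sc (a xor b) one              ∎)
  where
  open ≃-Reasoning
  B : Poly
  B = sc b one
  shift : ∀ A B q x → (A +ₚ x *ₚ ((one +ₚ x) *ₚ q +ₚ B)) +ₚ (B +ₚ B)
                      ≃ (one +ₚ x) *ₚ (x *ₚ q +ₚ B) +ₚ (A +ₚ B)
  shift = solve 4 (λ A B q x → (A :+ x :* ((con 1 :+ x) :* q :+ B)) :+ (B :+ B)
                               := (con 1 :+ x) :* (x :* q :+ B) :+ (A :+ B)) ≃-refl

-- A linear polynomial divides p(p+1): one of p, p+1 has remainder zero.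
linear-∣-p[p+1] : ∀ {L p} → LinearDivision L p → L ∣ p *ₚ (p +ₚ one)
linear-∣-p[p+1] {L} {p} (linearDivision q r e) =
  divides (q *ₚ (L *ₚ q +ₚ one)) (≃-trans (by-remainder r) (≃-sym (*-cong e (+-cong e (≃-refl {one})))))
  where
  open ≃-Reasoning
  Lq = L *ₚ q
  by-remainder : ∀ r → L *ₚ (q *ₚ (Lq +ₚ one)) ≃ (Lq +ₚ sc r one) *ₚ ((Lq +ₚ sc r one) +ₚ one)
  by-remainder false = solve 2 (λ L q → L :* (q :* (L :* q :+ con 1))
                                        := (L :* q :+ con 0) :* ((L :* q :+ con 0) :+ con 1)) ≃-refl L q
  by-remainder true = begin
    L *ₚ (q *ₚ (Lq +ₚ one))          ≈⟨ solve 2 (λ L q → L :* (q :* (L :* q :+ con 1))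
                                                        := (L :* q :+ con 1) :* (L :* q)) ≃-refl L q ⟩
    (Lq +ₚ one) *ₚ Lq                ≈⟨ *-cong (≃-refl {Lq +ₚ one}) (≃-sym (≃-trans (≡⇒≃ (+-assoc-≡ Lq one one))
                                                                           (add-zero-as-double Lq one))) ⟩
    (Lq +ₚ one) *ₚ ((Lq +ₚ one) +ₚ one) ∎

module GeometricSum (S : Poly) where

  -- Q = S(S + 1) and G h = Σ_{i<h} S^{2i}, so that σ(S^{2h}) = 1 + Q·G h.
  Q : Poly
  Q = S *ₚ (S +ₚ one)

  G : ℕ → Poly
  G zero = []
  G (suc h) = G h +ₚ S ^ₚ (2 * h)

  P : ℕ → Poly
  P h = geomSum S (2 * h)

  P-step : ∀ h → P (suc h) ≡ (P h +ₚ S *ₚ S ^ₚ (2 * h)) +ₚ S *ₚ (S *ₚ S ^ₚ (2 * h))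
  P-step h = cong (geomSum S) (*-suc 2 h)

  even-power-step : ∀ h → S ^ₚ (2 * suc h) ≡ S *ₚ (S *ₚ S ^ₚ (2 * h))
  even-power-step h = cong (S ^ₚ_) (*-suc 2 h)

  -- σ(S^{2h}) ≡ 1 (mod S(S + 1)): add S^{2h}(S + S²) = Q·S^{2h} at each step.
  P≃1+QG : ∀ h → P h ≃ one +ₚ Q *ₚ G h
  P≃1+QG zero = ≃-sym (+-cong (≃-refl {one}) (*-zeroʳ Q))
  P≃1+QG (suc h) = begin
    P (suc h)                                         ≡⟨ P-step h ⟩
    (P h +ₚ S *ₚ T) +ₚ S *ₚ (S *ₚ T)                  ≈⟨ +-cong (+-cong (P≃1+QG h) ≃-refl) ≃-refl ⟩
    ((one +ₚ Q *ₚ G h) +ₚ S *ₚ T) +ₚ S *ₚ (S *ₚ T)    ≈⟨ collect S (G h) T ⟩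
    one +ₚ Q *ₚ (G h +ₚ T)                            ∎
    where
    open ≃-Reasoning
    T = S ^ₚ (2 * h)
    collect : ∀ S G T → ((one +ₚ (S *ₚ (S +ₚ one)) *ₚ G) +ₚ S *ₚ T) +ₚ S *ₚ (S *ₚ T)
                        ≃ one +ₚ (S *ₚ (S +ₚ one)) *ₚ (G +ₚ T)
    collect = solve 3 (λ S G T → ((con 1 :+ (S :* (S :+ con 1)) :* G) :+ S :* T) :+ S :* (S :* T)
                                 := con 1 :+ (S :* (S :+ con 1)) :* (G :+ T)) ≃-refl

  -- σ(S^{2h}) = G h·(1 + S) + S^{2h}: pair the terms S^{2i}, S^{2i+1} for i < h.
  P≃G[1+S]+T : ∀ h → P h ≃ G h *ₚ (one +ₚ S) +ₚ S ^ₚ (2 * h)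
  P≃G[1+S]+T zero = ≃-refl
  P≃G[1+S]+T (suc h) = begin
    P (suc h)                                             ≡⟨ P-step h ⟩
    (P h +ₚ S *ₚ T) +ₚ S *ₚ (S *ₚ T)                      ≈⟨ +-cong (+-cong (P≃G[1+S]+T h) ≃-refl) ≃-refl ⟩
    ((G h *ₚ (one +ₚ S) +ₚ T) +ₚ S *ₚ T) +ₚ S *ₚ (S *ₚ T)  ≈⟨ pair S (G h) T ⟩
    (G h +ₚ T) *ₚ (one +ₚ S) +ₚ S *ₚ (S *ₚ T)              ≡⟨ cong (G (suc h) *ₚ (one +ₚ S) +ₚ_) (sym (even-power-step h)) ⟩
    G (suc h) *ₚ (one +ₚ S) +ₚ S ^ₚ (2 * suc h)            ∎
    where
    open ≃-Reasoning
    T = S ^ₚ (2 * h)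
    pair : ∀ S G T → ((G *ₚ (one +ₚ S) +ₚ T) +ₚ S *ₚ T) +ₚ S *ₚ (S *ₚ T)
                     ≃ (G +ₚ T) *ₚ (one +ₚ S) +ₚ S *ₚ (S *ₚ T)
    pair = solve 3 (λ S G T → ((G :* (con 1 :+ S) :+ T) :+ S :* T) :+ S :* (S :* T)
                              := (G :+ T) :* (con 1 :+ S) :+ S :* (S :* T)) ≃-refl

  -- Even powers are squares, so they have derivative zero; hence so does G h.
  D-even-power : ∀ h → D (S ^ₚ (2 * h)) ≃ []
  D-even-power zero = D-one
  D-even-power (suc h) = begin
    D (S ^ₚ (2 * suc h))                             ≡⟨ cong D (even-power-step h) ⟩
    D (S *ₚ (S *ₚ T))                                ≈⟨ D-cong (≃-sym (*-assoc S S T)) ⟩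
    D ((S *ₚ S) *ₚ T)                                ≈⟨ D-* (S *ₚ S) T ⟩
    D (S *ₚ S) *ₚ T +ₚ (S *ₚ S) *ₚ D T               ≈⟨ +-cong (*-cong (D-square S) ≃-refl) (*-cong (≃-refl {S *ₚ S}) (D-even-power h)) ⟩
    [] *ₚ T +ₚ (S *ₚ S) *ₚ []                        ≈⟨ *-zeroʳ (S *ₚ S) ⟩
    []                                               ∎
    where
    open ≃-Reasoning
    T = S ^ₚ (2 * h)

  D-G : ∀ h → D (G h) ≃ []
  D-G zero = ≃-refl
  D-G (suc h) = ≃-trans (D-+ (G h) (S ^ₚ (2 * h))) (+-cong (D-G h) (D-even-power h))

  D-Q : D Q ≃ D S
  D-Q = begin
    D (S *ₚ (S +ₚ one))                          ≈⟨ D-* S (S +ₚ one) ⟩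
    D S *ₚ (S +ₚ one) +ₚ S *ₚ D (S +ₚ one)       ≈⟨ +-cong ≃-refl (*-cong (≃-refl {S}) (≃-trans (D-+ S one) (+-cong ≃-refl D-one))) ⟩
    D S *ₚ (S +ₚ one) +ₚ S *ₚ (D S +ₚ [])        ≈⟨ expand (D S) S ⟩
    D S +ₚ (S *ₚ D S +ₚ S *ₚ D S)                ≈⟨ add-zero-as-double (D S) (S *ₚ D S) ⟩
    D S                                          ∎
    where
    open ≃-Reasoning
    expand : ∀ DS S → DS *ₚ (S +ₚ one) +ₚ S *ₚ (DS +ₚ []) ≃ DS +ₚ (S *ₚ DS +ₚ S *ₚ DS)
    expand = solve 2 (λ DS S → DS :* (S :+ con 1) :+ S :* (DS :+ con 0) := DS :+ (S :* DS :+ S :* DS)) ≃-refl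

  D-P : ∀ h → D (P h) ≃ D S *ₚ G h
  D-P h = begin
    D (P h)                          ≈⟨ D-cong (P≃1+QG h) ⟩
    D (one +ₚ Q *ₚ G h)              ≈⟨ ≃-trans (D-+ one (Q *ₚ G h)) (+-cong D-one ≃-refl) ⟩
    [] +ₚ D (Q *ₚ G h)               ≈⟨ D-* Q (G h) ⟩
    D Q *ₚ G h +ₚ Q *ₚ D (G h)       ≈⟨ +-cong (*-cong D-Q ≃-refl) (≃-trans (*-cong (≃-refl {Q}) (D-G h)) (*-zeroʳ Q)) ⟩
    D S *ₚ G h +ₚ []                 ≈⟨ ≡⇒≃ (+-identityʳ-≡ (D S *ₚ G h)) ⟩
    D S *ₚ G h                       ∎
    where open ≃-Reasoning

  -- Both linear polynomials divide Q = S(S + 1), so neither divides σ(S^{2h}) ≡ 1 (mod Q).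
  odd : ∀ h → Odd (P h)
  odd h = (λ { (c , e) → X≄1 (linear-not-∣ (divide-by-X S) (divides c (eqv e))) })
        , (λ { (c , e) → X+1≄1 (linear-not-∣ (divide-by-X+1 S) (divides c (eqv e))) })
    where
    linear-not-∣ : ∀ {L} → LinearDivision L S → L ∣ P h → L ≃ one
    linear-not-∣ division L∣P = coprime-divisor-unit L∣P (P≃1+QG h) (linear-∣-p[p+1] division)
    X≄1 : ¬ (X ≃ one)
    X≄1 (eqv ())
    X+1≄1 : ¬ (X+1 ≃ one)
    X+1≄1 (eqv ())

  -- A repeated factor d of σ(S^{2h}) divides S′: it divides S′·G h = σ(S^{2h})′,
  -- hence S′·S^{2h} = S′·σ(S^{2h}) + (1 + S)·S′·G h, and d is coprime to S.
  square-factor-∣-D : ∀ h d → d *ₚ d ∣ P h → d ∣ D S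
  square-factor-∣-D h d dd∣P = cancel-coprime-power {Q = S} (2 * h) (D S) d∣P P≃1+S·C d∣TD
    where
    T = S ^ₚ (2 * h)
    d∣P : d ∣ P h
    d∣P = square-∣ dd∣P
    d∣DG : d ∣ D S *ₚ G h
    d∣DG = ∣-respʳ (square-∣-derivative dd∣P) (D-P h)
    U = (D S *ₚ G h) *ₚ (one +ₚ S)
    expand : ∀ DS G S T → DS *ₚ (G *ₚ (one +ₚ S) +ₚ T) +ₚ (DS *ₚ G) *ₚ (one +ₚ S)
                          ≃ T *ₚ DS +ₚ ((DS *ₚ G) *ₚ (one +ₚ S) +ₚ (DS *ₚ G) *ₚ (one +ₚ S))
    expand = solve 4 (λ DS G S T → DS :* (G :* (con 1 :+ S) :+ T) :+ (DS :* G) :* (con 1 :+ S)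
                                   := T :* DS :+ ((DS :* G) :* (con 1 :+ S) :+ (DS :* G) :* (con 1 :+ S))) ≃-refl
    d∣TD : d ∣ T *ₚ D S
    d∣TD = ∣-respʳ (∣-+ (∣-*ˡ (D S) d∣P) (∣-*ʳ (one +ₚ S) d∣DG))
             (≃-trans (+-cong (*-cong (≃-refl {D S}) (P≃G[1+S]+T h)) ≃-refl)
             (≃-trans (expand (D S) (G h) S T) (add-zero-as-double (T *ₚ D S) U)))
    P≃1+S·C : P h ≃ one +ₚ S *ₚ ((S +ₚ one) *ₚ G h)
    P≃1+S·C = ≃-trans (P≃1+QG h) (+-cong (≃-refl {one}) (*-assoc S (S +ₚ one) (G h)))

  -- If S′ ∣ Q², a repeated factor of σ(S^{2h}) divides Q² and hence is a unit.
  squareFree : D S ∣ Q *ₚ Q → ∀ h → SquareFree (P h)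
  squareFree D∣Q² h d (c , e) = prf (coprime-divisor-unit d∣P (P≃1+QG h) d∣Q)
    where
    dd∣P : d *ₚ d ∣ P h
    dd∣P = divides c (eqv e)
    d∣P : d ∣ P h
    d∣P = square-∣ dd∣P
    d∣Q : d ∣ Q
    d∣Q = cancel-coprime {Q = Q} Q d∣P (P≃1+QG h) (∣-trans (square-factor-∣-D h d dd∣P) D∣Q²)

monomials : List ℕ → Poly
monomials = foldr (λ e p → X ^ₚ e +ₚ p) []

-- S′ divides (S(S + 1))²; for the candidates the cofactor is given explicitly
-- and the identity is checked by evaluation.
DerivativeCondition : Poly → Set
DerivativeCondition S = D S ∣ Q *ₚ Q
  where open GeometricSum S

derivative-conditions : All DerivativeCondition candidates
derivative-conditions =
    divides (monomials (2 ∷ 4 ∷ [])) (eqv refl)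
  ∷ divides (monomials (2 ∷ 4 ∷ [])) (eqv refl)
  ∷ divides (monomials (2 ∷ 8 ∷ [])) (eqv refl)
  ∷ divides (monomials (2 ∷ 6 ∷ 8 ∷ 10 ∷ [])) (eqv refl)
  ∷ divides (monomials (2 ∷ 4 ∷ 6 ∷ 10 ∷ [])) (eqv refl)
  ∷ divides (monomials (2 ∷ 4 ∷ 12 ∷ 14 ∷ [])) (eqv refl)
  ∷ divides (monomials (4 ∷ 6 ∷ 10 ∷ 14 ∷ [])) (eqv refl)
  ∷ divides (monomials (4 ∷ 6 ∷ 10 ∷ 12 ∷ 14 ∷ 16 ∷ [])) (eqv refl)
  ∷ divides (monomials (4 ∷ 8 ∷ 10 ∷ 14 ∷ 18 ∷ 22 ∷ [])) (eqv refl)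
  ∷ divides (monomials (6 ∷ 8 ∷ 18 ∷ 22 ∷ [])) (eqv refl)
  ∷ divides (monomials (2 ∷ 8 ∷ 14 ∷ 16 ∷ [])) (eqv refl)
  ∷ divides (monomials (4 ∷ 8 ∷ 12 ∷ 14 ∷ 20 ∷ 22 ∷ [])) (eqv refl)
  ∷ divides (monomials (2 ∷ 8 ∷ 20 ∷ 22 ∷ [])) (eqv refl)
  ∷ divides (monomials (2 ∷ 4 ∷ 10 ∷ 12 ∷ 20 ∷ 28 ∷ [])) (eqv refl)
  ∷ divides (monomials (8 ∷ 10 ∷ 24 ∷ 28 ∷ [])) (eqv refl)
  ∷ divides (monomials (2 ∷ 4 ∷ 8 ∷ 16 ∷ [])) (eqv refl)
  ∷ divides (monomials (2 ∷ 6 ∷ 18 ∷ 20 ∷ [])) (eqv refl)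
  ∷ divides (monomials (2 ∷ 4 ∷ 6 ∷ 8 ∷ 10 ∷ 12 ∷ 28 ∷ 30 ∷ 32 ∷ 34 ∷ 36 ∷ 38 ∷ [])) (eqv refl)
  ∷ divides (monomials (4 ∷ 22 ∷ [])) (eqv refl)
  ∷ divides (monomials (2 ∷ 6 ∷ 16 ∷ 18 ∷ 20 ∷ 22 ∷ [])) (eqv refl)
  ∷ divides (monomials (4 ∷ 6 ∷ 8 ∷ 12 ∷ 14 ∷ 18 ∷ 22 ∷ 26 ∷ 30 ∷ 38 ∷ [])) (eqv refl)
  ∷ divides (monomials (2 ∷ 8 ∷ 12 ∷ 14 ∷ 18 ∷ 22 ∷ 26 ∷ 28 ∷ [])) (eqv refl)
  ∷ divides (monomials (4 ∷ 6 ∷ 14 ∷ 16 ∷ 22 ∷ 24 ∷ 26 ∷ 28 ∷ [])) (eqv refl)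
  ∷ divides (monomials (2 ∷ 4 ∷ 6 ∷ 10 ∷ 12 ∷ 16 ∷ 20 ∷ 24 ∷ 36 ∷ 40 ∷ [])) (eqv refl)
  ∷ divides (monomials (2 ∷ 8 ∷ 10 ∷ 22 ∷ [])) (eqv refl)
  ∷ divides (monomials (2 ∷ 6 ∷ 16 ∷ [])) (eqv refl)
  ∷ divides (monomials (2 ∷ 6 ∷ 10 ∷ 18 ∷ 20 ∷ 22 ∷ [])) (eqv refl)
  ∷ divides (monomials (2 ∷ 4 ∷ 6 ∷ 10 ∷ 16 ∷ 18 ∷ 20 ∷ 22 ∷ [])) (eqv refl)
  ∷ divides (monomials (0 ∷ 4 ∷ 6 ∷ 16 ∷ [])) (eqv refl)
  ∷ divides (monomials (2 ∷ 4 ∷ 8 ∷ 10 ∷ 16 ∷ 22 ∷ [])) (eqv refl)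
  ∷ []

lemma3p22 : ∀ (h : ℕ) → h ≥ 1 → ∀ (S : Poly) → S ∈ candidates →
    Odd (geomSum S (2 * h)) × SquareFree (geomSum S (2 * h))
lemma3p22 h _ S S∈candidates = odd h , squareFree (lookup derivative-conditions S∈candidates) h
  where open GeometricSum S
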